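{- Let $m>n$ be positive integers and $\alpha$ a composition of $n$. Then, as polynomials in $p,q$, $$\sum_{P\in\mathcal{D}_{m,\alpha}}p^{\mathrm{run}(P)}q^{\mathrm{ret}(P)}=\sum_{P\in\mathcal{D}_{m,\alpha}}p^{\mathrm{ret}(P)}q^{\mathrm{run}(P)},\qquad \sum_{P\in\mathcal{D}_{m,n}}p^{\mathrm{run}(P)}q^{\mathrm{ret}(P)}=\sum_{P\in\mathcal{D}_{m,n}}p^{\mathrm{ret}(P)}q^{\mathrm{run}(P)}.$$
   Context: An $m\times n$ rational Dyck path is a lattice path from $(0,0)$ to $(m,n)$ using unit north steps $N$ and east steps $E$ that stays weakly above the line $y=nx/m$; $\mathcal{D}_{m,n}$ is the set of these paths. For $P\in\mathcal{D}_{m,n}$, let $u_i$ be the $x$-coordinate of the $i$-th north step of $P$ (bottom to top). Define $\mathrm{run}(P)=\min\{i\in\{1,\dots,n\}: i\notin\{u_1,\dots,u_n\}\}$. Let $\mathrm{ret}(P)$ be the number of north steps of $P$ from some $(i,j)$ to $(i,j+1)$ with $jm-in<n$. The composition type $\mathrm{comp}(P)$ is the composition of $n$ given by the lengths of the maximal blocks of consecutive north steps of $P$, in order, and $\mathcal{D}_{m,\alpha}=\{P\in\mathcal{D}_{m,n}:\mathrm{comp}(P)=\alpha\}$. -}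

module Defs where

open import Data.Nat using (ℕ; zero; suc; _+_; _*_; _≤_; _<_; _≟_; _≤?_; _<?_)
open import Data.Bool using (Bool; true; false; _∧_; if_then_else_)
open import Data.List using (List; []; _∷_; _++_; map; filter; length)
open import Data.Nat.ListAction using (sum)
open import Data.List.Relation.Unary.All using (All)
open import Data.List.Properties using (≡-dec)
open import Data.Product using (_×_)
open import Relation.Nullary.Decidable using (⌊_⌋; _×-dec_)
open import Relation.Binary.PropositionalEquality using (_≡_)

data Step : Set where
  N E : Step

lattice : ℕ → ℕ → List (List Step)
lattice zero    zero    = [] ∷ []
lattice zero    (suc k) = map (N ∷_) (lattice zero k)
lattice (suc e) zero    = map (E ∷_) (lattice e zero)
lattice (suc e) (suc k) = map (N ∷_) (lattice (suc e) k) ++ map (E ∷_) (lattice e (suc k))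

aboveFrom : ℕ → ℕ → ℕ → ℕ → List Step → Bool
aboveFrom m n x y []      = ⌊ n * x ≤? m * y ⌋
aboveFrom m n x y (N ∷ s) = ⌊ n * x ≤? m * y ⌋ ∧ aboveFrom m n x (suc y) s
aboveFrom m n x y (E ∷ s) = ⌊ n * x ≤? m * y ⌋ ∧ aboveFrom m n (suc x) y s

D : ℕ → ℕ → List (List Step)
D m n = filter (λ P → aboveFrom m n 0 0 P Data.Bool.≟ true) (lattice m n)

northXsFrom : ℕ → List Step → List ℕ
northXsFrom x []      = []
northXsFrom x (N ∷ s) = x ∷ northXsFrom x s
northXsFrom x (E ∷ s) = northXsFrom (suc x) s

memb : ℕ → List ℕ → Bool
memb i []       = false
memb i (u ∷ us) = if ⌊ i ≟ u ⌋ then true else memb i us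

-- least i ∈ {j, j+1, …, j+k-1} not in us; returns j+k if none
firstMissing : ℕ → ℕ → List ℕ → ℕ
firstMissing j zero    us = j
firstMissing j (suc k) us = if memb j us then firstMissing (suc j) k us else j

-- run(P) = min { i ∈ {1..n} : i ∉ {u₁..uₙ} }  (always exists for Dyck paths)
run : ℕ → List Step → ℕ
run n P = firstMissing 1 n (northXsFrom 0 P)

-- number of north steps from (i,j) to (i,j+1) with j*m - i*n < n  (i.e. j*m < i*n + n)
retFrom : ℕ → ℕ → ℕ → ℕ → List Step → ℕ
retFrom m n i j []      = 0
retFrom m n i j (N ∷ s) = (if ⌊ j * m <? i * n + n ⌋ then 1 else 0) + retFrom m n i (suc j) s
retFrom m n i j (E ∷ s) = retFrom m n (suc i) j s

ret : ℕ → ℕ → List Step → ℕ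
ret m n P = retFrom m n 0 0 P

-- composition type: lengths of maximal blocks of consecutive north steps, in order
compAux : ℕ → List Step → List ℕ
compAux zero    []      = []
compAux (suc c) []      = suc c ∷ []
compAux c       (N ∷ s) = compAux (suc c) s
compAux zero    (E ∷ s) = compAux zero s
compAux (suc c) (E ∷ s) = suc c ∷ compAux zero s

comp : List Step → List ℕ
comp P = compAux 0 P

IsComposition : ℕ → List ℕ → Set
IsComposition n α = All (0 <_) α × sum α ≡ n

Dcomp : ℕ → ℕ → List ℕ → List (List Step)
Dcomp m n α = filter (λ P → ≡-dec _≟_ (comp P) α) (D m n)

-- coefficient of p^a q^b in Σ_{P ∈ Ps} p^{f P} q^{g P}
coeff : List (List Step) → (List Step → ℕ) → (List Step → ℕ) → ℕ → ℕ → ℕ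
coeff Ps f g a b = length (filter (λ P → (f P ≟ a) ×-dec (g P ≟ b)) Ps)

{-# OPTIONS --safe #-}
-- A path P with composition α is determined by the abscissae v₀ < v₁ < … of its blocks of north
-- steps, i.e. by the weakly increasing sequence wⱼ = vⱼ − j.  If block j starts at height Sⱼ, then P
-- stays above the diagonal iff wⱼ ≤ dⱼ = ⌊m Sⱼ / n⌋ − j for all j, and d is weakly increasing with
-- d₀ = 0.  Then run(P) is the number of leading zeros of w, and ret(P) is the number of hits wⱼ = dⱼ:
-- as m ≥ n, only the lowest north step of a block can satisfy j m − i n < n.
--
-- So it suffices to find an involution on the weakly increasing sequences w ≤ d that exchanges leading
-- zeros and hits.  Positions with dⱼ = 0 force wⱼ = 0 and count towards both statistics, so let d > 0.
-- Write w = 0ᵗ ++ (1 + x), where x is bounded by d − 1 without its first t entries.  By induction on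
-- max d we have Φ x = 0ˢ ++ μ, where s is the number of hits of x, and we put
-- Φ w = 0ˢ ++ (1 + Φ (0ᵗ ++ μ)).  This has s leading zeros and t hits, and applying the same
-- construction to it gives back w.

module Submission where

open import Defs
open import Data.Bool using (Bool; true; false; if_then_else_; _∧_) renaming (_≟_ to _≟ᵇ_)
open import Data.Bool.Properties using (∧-zeroʳ)
open import Data.Empty using (⊥)
open import Data.List using (List; []; _∷_; _++_; map; replicate; drop; length; filter)
open import Data.List.Extrema.Nat using (max; xs≤max)
open import Data.List.Membership.Propositional using (_∈_)
open import Data.List.Membership.Propositional.Properties
  using (∈-map⁺; ∈-map⁻; ∈-++⁺ˡ; ∈-++⁺ʳ; ∈-++⁻; ∈-∃++; ∈-filter⁺; ∈-filter⁻)
open import Data.List.Properties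
  using (≡-dec; ++-identityʳ; ∷-injectiveʳ; length-++; drop-drop; drop-map; length-drop; length-map; map-∘; map-id; map-id-local)
open import Data.List.Relation.Binary.Subset.Propositional using (_⊆_)
open import Data.List.Relation.Unary.All as All using (All; []; _∷_)
import Data.List.Relation.Unary.All.Properties as All
open import Data.List.Relation.Unary.AllPairs using ([]; _∷_)
open import Data.List.Relation.Unary.Any using (here; there)
open import Data.List.Relation.Unary.Unique.Propositional using (Unique)
import Data.List.Relation.Unary.Unique.Propositional.Properties as Unique
open import Data.Nat
open import Data.Nat.DivMod using (_/_; 0/n≡0; m*n/n≡m; /-monoˡ-≤; m/n*n≤m; m≡m%n+[m/n]*n; m%n<n)
open import Data.Nat.ListAction using (sum)
open import Data.Nat.Properties
open import Data.Product using (_×_; _,_; proj₁; proj₂)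
open import Data.Sum using (inj₁; inj₂)
open import Relation.Binary.PropositionalEquality
open import Relation.Nullary.Decidable using (Dec; ⌊_⌋; yes; no; isYes≗does; _×-dec_)
open import Relation.Nullary.Negation using (¬_; contradiction)
open import Relation.Unary using (Decidable)

⌊⌋-true : ∀ {A : Set} (a? : Dec A) → A → ⌊ a? ⌋ ≡ true
⌊⌋-true (yes _) _ = refl
⌊⌋-true (no ¬a) a = contradiction a ¬a

⌊⌋-false : ∀ {A : Set} (a? : Dec A) → ¬ A → ⌊ a? ⌋ ≡ false
⌊⌋-false (yes a) ¬a = contradiction a ¬a
⌊⌋-false (no _)  _  = refl

⌊⌋-sound : ∀ {A : Set} (a? : Dec A) → ⌊ a? ⌋ ≡ true → A
⌊⌋-sound (yes a) _ = a

∧-true⁻ : ∀ {a b} → a ∧ b ≡ true → a ≡ true × b ≡ true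
∧-true⁻ {true} b≡true = refl , b≡true

-- Counting with an involution

module _ {a} {A : Set a} where

  Unique-length-≤ : ∀ {ys zs : List A} → Unique ys → ys ⊆ zs → length ys ≤ length zs
  Unique-length-≤ {[]}     _              _    = z≤n
  Unique-length-≤ {y ∷ ys} (y∉ys ∷ uniq) ys⊆zs with zs₁ , zs₂ , refl ← ∈-∃++ (ys⊆zs (here refl)) =
    subst (suc (length ys) ≤_) (sym ∣zs₁++y∷zs₂∣) (s≤s (Unique-length-≤ uniq ys⊆zs₁++zs₂))
    where
    ∣zs₁++y∷zs₂∣ : length (zs₁ ++ y ∷ zs₂) ≡ suc (length (zs₁ ++ zs₂))
    ∣zs₁++y∷zs₂∣ = trans (length-++ zs₁) (trans (+-suc (length zs₁) (length zs₂)) (cong suc (sym (length-++ zs₁))))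
    ys⊆zs₁++zs₂ : ys ⊆ zs₁ ++ zs₂
    ys⊆zs₁++zs₂ {x} x∈ys with ∈-++⁻ zs₁ (ys⊆zs (there x∈ys))
    ... | inj₁ x∈zs₁        = ∈-++⁺ˡ x∈zs₁
    ... | inj₂ (here refl)  = contradiction refl (All.lookup y∉ys x∈ys)
    ... | inj₂ (there x∈zs₂) = ∈-++⁺ʳ zs₁ x∈zs₂

  Unique-map-injectiveOn : ∀ (f : A → A) {xs} → Unique xs → (∀ {x y} → x ∈ xs → y ∈ xs → f x ≡ f y → x ≡ y) →
                           Unique (map f xs)
  Unique-map-injectiveOn f {[]}     _              _   = []
  Unique-map-injectiveOn f {x ∷ xs} (x∉xs ∷ uniq) inj =
    All.map⁺ (All.tabulate (λ y∈xs fx≡fy → All.lookup x∉xs y∈xs (inj (here refl) (there y∈xs) fx≡fy)))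
    ∷ Unique-map-injectiveOn f uniq (λ x∈ y∈ → inj (there x∈) (there y∈))

  module _ {p q} {P : A → Set p} {Q : A → Set q} (P? : Decidable P) (Q? : Decidable Q)
           {xs : List A} (uniq : Unique xs) (ι : A → A)
           (ι-closed : ∀ {x} → x ∈ xs → ι x ∈ xs) (ι-involutive : ∀ {x} → x ∈ xs → ι (ι x) ≡ x) where

    length-filter-≤-involution : (∀ {x} → x ∈ xs → P x → Q (ι x)) → length (filter P? xs) ≤ length (filter Q? xs)
    length-filter-≤-involution P⇒Qι =
      subst (_≤ length (filter Q? xs)) (length-map ι (filter P? xs))
            (Unique-length-≤ (Unique-map-injectiveOn ι (Unique.filter⁺ P? uniq) injective) image⊆)
      where
      injective : ∀ {x y} → x ∈ filter P? xs → y ∈ filter P? xs → ι x ≡ ι y → x ≡ y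
      injective x∈ y∈ ιx≡ιy = trans (sym (ι-involutive (proj₁ (∈-filter⁻ P? x∈))))
                                    (trans (cong ι ιx≡ιy) (ι-involutive (proj₁ (∈-filter⁻ P? y∈))))
      image⊆ : map ι (filter P? xs) ⊆ filter Q? xs
      image⊆ z∈ with x , x∈ , refl ← ∈-map⁻ ι z∈ =
        let x∈xs , Px = ∈-filter⁻ P? x∈ in ∈-filter⁺ Q? (ι-closed x∈xs) (P⇒Qι x∈xs Px)

coeff-swap : ∀ {Ps} (ι : List Step → List Step) {f g : List Step → ℕ} → Unique Ps →
             (∀ {P} → P ∈ Ps → ι P ∈ Ps) → (∀ {P} → P ∈ Ps → ι (ι P) ≡ P) →
             (∀ {P} → P ∈ Ps → f (ι P) ≡ g P) → (∀ {P} → P ∈ Ps → g (ι P) ≡ f P) →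
             ∀ a b → coeff Ps f g a b ≡ coeff Ps g f a b
coeff-swap ι {f} {g} uniq closed involutive fι≡g gι≡f a b = ≤-antisym
  (length-filter-≤-involution fg? gf? uniq ι closed involutive (λ P∈ (fa , gb) → trans (gι≡f P∈) fa , trans (fι≡g P∈) gb))
  (length-filter-≤-involution gf? fg? uniq ι closed involutive (λ P∈ (ga , fb) → trans (fι≡g P∈) ga , trans (gι≡f P∈) fb))
  where
  fg? = λ P → (f P ≟ a) ×-dec (g P ≟ b)
  gf? = λ P → (g P ≟ a) ×-dec (f P ≟ b)

-- Weakly increasing sequences under a bound

drop-replicate-++ : ∀ {a} {A : Set a} k {x : A} ys → drop k (replicate k x ++ ys) ≡ ys
drop-replicate-++ zero    ys = refl
drop-replicate-++ (suc k) ys = drop-replicate-++ k ys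

map-pred-suc : ∀ w → map pred (map suc w) ≡ w
map-pred-suc w = trans (sym (map-∘ w)) (map-id w)

map-suc-pred : ∀ {w} → All (0 <_) w → map suc (map pred w) ≡ w
map-suc-pred {w} pos = trans (sym (map-∘ w)) (map-id-local (All.map (λ { (s≤s _) → refl }) pos))

drop-comm : ∀ {a} {A : Set a} t s (d : List A) → drop s (drop t d) ≡ drop t (drop s d)
drop-comm t s d = trans (drop-drop t s d) (trans (cong (λ k → drop k d) (+-comm t s)) (sym (drop-drop s t d)))

data Under : ℕ → List ℕ → List ℕ → Set where
  []   : ∀ {lo} → Under lo [] []
  cons : ∀ {lo x e d w} → lo ≤ x → x ≤ e → Under x d w → Under lo (e ∷ d) (x ∷ w)

Increasing : List ℕ → Set
Increasing d = Under 0 d d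

leadingZeros : List ℕ → ℕ
leadingZeros (zero ∷ w) = suc (leadingZeros w)
leadingZeros _          = 0

hits : List ℕ → List ℕ → ℕ
hits (e ∷ d) (x ∷ w) = (if ⌊ x ≟ e ⌋ then 1 else 0) + hits d w
hits _       _       = 0

Under-weaken : ∀ {lo lo′ d w} → lo′ ≤ lo → Under lo d w → Under lo′ d w
Under-weaken lo′≤lo []                = []
Under-weaken lo′≤lo (cons lo≤x x≤e u) = cons (≤-trans lo′≤lo lo≤x) x≤e u

Under-length : ∀ {lo d w} → Under lo d w → length d ≡ length w
Under-length []           = refl
Under-length (cons _ _ u) = cong suc (Under-length u)

Under-drop : ∀ {lo d w} k → Under lo d w → Under 0 (drop k d) (drop k w)
Under-drop zero    u            = Under-weaken z≤n u
Under-drop (suc k) []           = []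
Under-drop (suc k) (cons _ _ u) = Under-drop k u

Under-pred : ∀ {lo d w} → Under lo d w → Under (pred lo) (map pred d) (map pred w)
Under-pred []                = []
Under-pred (cons lo≤x x≤e u) = cons (pred-mono-≤ lo≤x) (pred-mono-≤ x≤e) (Under-pred u)

Under-suc : ∀ {lo d w} → Under lo d w → Under (suc lo) (map suc d) (map suc w)
Under-suc []                = []
Under-suc (cons lo≤x x≤e u) = cons (s≤s lo≤x) (s≤s x≤e) (Under-suc u)

Under-lowerBound : ∀ {lo d w} → Under lo d w → All (lo ≤_) w
Under-lowerBound []              = []
Under-lowerBound (cons lo≤x _ u) = lo≤x ∷ All.map (≤-trans lo≤x) (Under-lowerBound u)

Under-noLeadingZero : ∀ {d w} → Under 0 d w → leadingZeros w ≡ 0 → Under 1 d w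
Under-noLeadingZero []                          _ = []
Under-noLeadingZero (cons {x = suc _} _ x≤e u) _ = cons (s≤s z≤n) x≤e u

Under-replicate⁻ : ∀ {lo} k d μ → Under lo d (replicate k 0 ++ μ) → Under 0 (drop k d) μ × k ≤ length d
Under-replicate⁻ zero    d       μ u            = Under-weaken z≤n u , z≤n
Under-replicate⁻ (suc k) (e ∷ d) μ (cons _ _ u) =
  let u′ , k≤ = Under-replicate⁻ k d μ (Under-weaken z≤n u) in u′ , s≤s k≤

Under-replicate⁺ : ∀ k d μ → Under 0 (drop k d) μ → k ≤ length d → Under 0 d (replicate k 0 ++ μ)
Under-replicate⁺ zero    d       μ u _         = u
Under-replicate⁺ (suc k) (e ∷ d) μ u (s≤s k≤) = cons z≤n z≤n (Under-replicate⁺ k d μ u k≤)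

Under-zeroBounds : ∀ {lo} a d w → Under lo (replicate a 0 ++ d) w → replicate a 0 ++ drop a w ≡ w
Under-zeroBounds zero    d w       u                = refl
Under-zeroBounds (suc a) d (x ∷ w) (cons _ z≤n u) = cong (0 ∷_) (Under-zeroBounds a d w u)

leadingZeros-split : ∀ w → replicate (leadingZeros w) 0 ++ drop (leadingZeros w) w ≡ w
leadingZeros-split []          = refl
leadingZeros-split (zero  ∷ w) = cong (0 ∷_) (leadingZeros-split w)
leadingZeros-split (suc _ ∷ w) = refl

leadingZeros-drop : ∀ w → leadingZeros (drop (leadingZeros w) w) ≡ 0
leadingZeros-drop []          = refl
leadingZeros-drop (zero  ∷ w) = leadingZeros-drop w
leadingZeros-drop (suc _ ∷ w) = refl

leadingZeros-++ : ∀ k w → leadingZeros (replicate k 0 ++ w) ≡ k + leadingZeros w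
leadingZeros-++ zero    w = refl
leadingZeros-++ (suc k) w = cong suc (leadingZeros-++ k w)

leadingZeros-replicate : ∀ k w → leadingZeros w ≡ 0 → leadingZeros (replicate k 0 ++ w) ≡ k
leadingZeros-replicate k w lz≡0 = trans (leadingZeros-++ k w) (trans (cong (k +_) lz≡0) (+-identityʳ k))

leadingZeros-map-suc : ∀ w → leadingZeros (map suc w) ≡ 0
leadingZeros-map-suc []      = refl
leadingZeros-map-suc (_ ∷ _) = refl

leadingZeros≤length : ∀ w → leadingZeros w ≤ length w
leadingZeros≤length []          = z≤n
leadingZeros≤length (zero  ∷ w) = s≤s (leadingZeros≤length w)
leadingZeros≤length (suc _ ∷ w) = z≤n

hits-map-suc : ∀ d w → hits (map suc d) (map suc w) ≡ hits d w
hits-map-suc (e ∷ d) (x ∷ w) = cong₂ (λ b r → (if b then 1 else 0) + r) (≟-suc x e) (hits-map-suc d w)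
  where
  ≟-suc : ∀ x e → ⌊ suc x ≟ suc e ⌋ ≡ ⌊ x ≟ e ⌋
  ≟-suc x e = trans (isYes≗does (suc x ≟ suc e)) (sym (isYes≗does (x ≟ e)))
hits-map-suc []      _  = refl
hits-map-suc (_ ∷ _) [] = refl

hits-replicate-zeros : ∀ k d w → hits (replicate k 0 ++ d) (replicate k 0 ++ w) ≡ k + hits d w
hits-replicate-zeros zero    d w = refl
hits-replicate-zeros (suc k) d w = cong suc (hits-replicate-zeros k d w)

leadingZeros≡hits-zeroBounds : ∀ {lo d w} → Under lo d w → All (_≤ 0) d → leadingZeros w ≡ hits d w
leadingZeros≡hits-zeroBounds []               _           = refl
leadingZeros≡hits-zeroBounds (cons _ z≤n u) (z≤n ∷ d≤0) = cong suc (leadingZeros≡hits-zeroBounds u d≤0)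

-- An involution exchanging leading zeros and hits

ZerosHitsInvolution : (List ℕ → Set) → (List ℕ → List ℕ → List ℕ) → Set
ZerosHitsInvolution Dom φ = ∀ {d w} → Dom d → Under 0 d w →
  Under 0 d (φ d w) × leadingZeros (φ d w) ≡ hits d w × φ d (φ d w) ≡ w

BoundedBy : ℕ → List ℕ → Set
BoundedBy B d = Increasing d × All (_≤ B) d

PositiveBoundedBy : ℕ → List ℕ → Set
PositiveBoundedBy B d = BoundedBy B d × All (0 <_) d

BoundedBy-drop : ∀ {B d} k → BoundedBy B d → BoundedBy B (drop k d)
BoundedBy-drop k (inc , d≤B) = Under-drop k inc , All.drop⁺ k d≤B

BoundedBy-pred : ∀ {B d} → BoundedBy (suc B) d → BoundedBy B (map pred d)
BoundedBy-pred (inc , d≤B) = Under-pred inc , All.map⁺ (All.map pred-mono-≤ d≤B)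

liftPositive : (List ℕ → List ℕ → List ℕ) → List ℕ → List ℕ → List ℕ
liftPositive φ d w = replicate s 0 ++ map suc (φ (drop s e) (replicate t 0 ++ drop s y))
  where
  e = map pred d
  t = leadingZeros w
  y = φ (drop t e) (map pred (drop t w))
  s = leadingZeros y

skipZeroBounds : (List ℕ → List ℕ → List ℕ) → List ℕ → List ℕ → List ℕ
skipZeroBounds ψ d w = replicate a 0 ++ ψ (drop a d) (drop a w)
  where a = leadingZeros d

-- B is fuel: an upper bound on d, which decreases when liftPositive passes to d − 1.
Φ : ℕ → List ℕ → List ℕ → List ℕ
Φ zero    d w = w
Φ (suc B)     = skipZeroBounds (liftPositive (Φ B))

liftPositive-replicate : ∀ φ d t x {s μ} →
  φ (drop t (map pred d)) x ≡ replicate s 0 ++ μ → leadingZeros μ ≡ 0 →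
  liftPositive φ d (replicate t 0 ++ map suc x) ≡
  replicate s 0 ++ map suc (φ (drop s (map pred d)) (replicate t 0 ++ μ))
liftPositive-replicate φ d t x {s} {μ} φx≡ lzμ
  rewrite leadingZeros-replicate t (map suc x) (leadingZeros-map-suc x)
        | drop-replicate-++ t {0} (map suc x) | map-pred-suc x | φx≡
        | leadingZeros-replicate s μ lzμ | drop-replicate-++ s {0} μ = refl

Under-swapZeros : ∀ t s d μ → t ≤ length d → Under 0 (drop t d) (replicate s 0 ++ μ) →
                  Under 0 (drop s d) (replicate t 0 ++ μ)
Under-swapZeros t s d μ t≤∣d∣ u =
  Under-replicate⁺ t (drop s d) μ (subst (λ D → Under 0 D μ) (drop-comm t s d) u′) t≤∣drop-s-d∣
  where
  split = Under-replicate⁻ s (drop t d) μ u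
  u′ = proj₁ split
  s+t≤∣d∣ : s + t ≤ length d
  s+t≤∣d∣ = m≤o∸n⇒m+n≤o s t≤∣d∣ (subst (s ≤_) (length-drop t d) (proj₂ split))
  t≤∣drop-s-d∣ : t ≤ length (drop s d)
  t≤∣drop-s-d∣ = subst (t ≤_) (sym (length-drop s d)) (m+n≤o⇒m≤o∸n t (subst (_≤ length d) (+-comm s t) s+t≤∣d∣))

Under-splitLeadingZeros : ∀ {d w} → Under 0 d w → let t = leadingZeros w; x = map pred (drop t w) in
  replicate t 0 ++ map suc x ≡ w × Under 0 (drop t (map pred d)) x
Under-splitLeadingZeros {d} {w} u =
  trans (cong (replicate t 0 ++_) (map-suc-pred (Under-lowerBound rest))) (leadingZeros-split w) ,
  subst (λ D → Under 0 D _) (sym (drop-map t d)) (Under-pred rest)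
  where
  t = leadingZeros w
  rest = Under-noLeadingZero (Under-drop t u) (leadingZeros-drop w)

Under-replicate-map-suc : ∀ s e z → Under 0 (drop s e) z → s ≤ length e →
                          Under 0 (map suc e) (replicate s 0 ++ map suc z)
Under-replicate-map-suc s e z u s≤∣e∣ =
  Under-replicate⁺ s (map suc e) (map suc z)
    (subst (λ D → Under 0 D (map suc z)) (sym (drop-map s e)) (Under-weaken z≤n (Under-suc u)))
    (subst (s ≤_) (sym (length-map suc e)) s≤∣e∣)

hits-replicate-map-suc : ∀ t e x → hits (map suc e) (replicate t 0 ++ map suc x) ≡ hits (drop t e) x
hits-replicate-map-suc zero    e       x = hits-map-suc e x
hits-replicate-map-suc (suc t) []      x = refl
hits-replicate-map-suc (suc t) (_ ∷ e) x = hits-replicate-map-suc t e x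

liftPositive-zerosHitsInvolution : ∀ {B φ} → ZerosHitsInvolution (BoundedBy B) φ →
                                   ZerosHitsInvolution (PositiveBoundedBy (suc B)) (liftPositive φ)
liftPositive-zerosHitsInvolution {φ = φ} φ-inv {d} {w} (bd , pos) u = Under-r , leadingZeros-r , involutive
  where
  e = map pred d
  d≡ : map suc e ≡ d
  d≡ = map-suc-pred pos
  t = leadingZeros w
  x = map pred (drop t w)
  w≡ = proj₁ (Under-splitLeadingZeros u)
  y = φ (drop t e) x
  φ-x = φ-inv (BoundedBy-drop t (BoundedBy-pred bd)) (proj₂ (Under-splitLeadingZeros u))
  s = leadingZeros y
  μ = drop s y
  y≡ : replicate s 0 ++ μ ≡ y
  y≡ = leadingZeros-split y
  u-y : Under 0 (drop t e) (replicate s 0 ++ μ)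
  u-y = subst (Under 0 (drop t e)) (sym y≡) (proj₁ φ-x)
  t≤∣e∣ : t ≤ length e
  t≤∣e∣ = subst (t ≤_) (sym (trans (length-map pred d) (Under-length u))) (leadingZeros≤length w)
  s≤∣e∣ : s ≤ length e
  s≤∣e∣ = ≤-trans (proj₂ (Under-replicate⁻ s (drop t e) μ u-y))
                  (subst (_≤ length e) (sym (length-drop t e)) (m∸n≤m (length e) t))
  z = φ (drop s e) (replicate t 0 ++ μ)
  φ-tμ = φ-inv (BoundedBy-drop s (BoundedBy-pred bd)) (Under-swapZeros t s e μ t≤∣e∣ u-y)
  r≡ : liftPositive φ d w ≡ replicate s 0 ++ map suc z
  r≡ = subst (λ w′ → liftPositive φ d w′ ≡ replicate s 0 ++ map suc z) w≡
             (liftPositive-replicate φ d t x (sym y≡) (leadingZeros-drop y))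
  Under-r : Under 0 d (liftPositive φ d w)
  Under-r = subst₂ (Under 0) d≡ (sym r≡) (Under-replicate-map-suc s e z (proj₁ φ-tμ) s≤∣e∣)
  leadingZeros-r : leadingZeros (liftPositive φ d w) ≡ hits d w
  leadingZeros-r = begin
    leadingZeros (liftPositive φ d w)                 ≡⟨ cong leadingZeros r≡ ⟩
    leadingZeros (replicate s 0 ++ map suc z)         ≡⟨ leadingZeros-replicate s (map suc z) (leadingZeros-map-suc z) ⟩
    s                                                 ≡⟨ proj₁ (proj₂ φ-x) ⟩
    hits (drop t e) x                                 ≡⟨ sym (hits-replicate-map-suc t e x) ⟩
    hits (map suc e) (replicate t 0 ++ map suc x)     ≡⟨ cong₂ hits d≡ w≡ ⟩
    hits d w                                          ∎
    where open ≡-Reasoning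
  involutive : liftPositive φ d (liftPositive φ d w) ≡ w
  involutive = begin
    liftPositive φ d (liftPositive φ d w)                        ≡⟨ cong (liftPositive φ d) r≡ ⟩
    liftPositive φ d (replicate s 0 ++ map suc z)                ≡⟨ liftPositive-replicate φ d s z (proj₂ (proj₂ φ-tμ)) (leadingZeros-drop y) ⟩
    replicate t 0 ++ map suc (φ (drop t e) (replicate s 0 ++ μ)) ≡⟨ cong (λ y′ → replicate t 0 ++ map suc (φ (drop t e) y′)) y≡ ⟩
    replicate t 0 ++ map suc (φ (drop t e) y)                    ≡⟨ cong (λ x′ → replicate t 0 ++ map suc x′) (proj₂ (proj₂ φ-x)) ⟩
    replicate t 0 ++ map suc x                                   ≡⟨ w≡ ⟩
    w                                                            ∎
    where open ≡-Reasoning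

skipZeroBounds-zerosHitsInvolution : ∀ {B ψ} → ZerosHitsInvolution (PositiveBoundedBy B) ψ →
                                     ZerosHitsInvolution (BoundedBy B) (skipZeroBounds ψ)
skipZeroBounds-zerosHitsInvolution {ψ = ψ} ψ-inv {d} {w} bd u = Under-r , leadingZeros-r , involutive
  where
  open ≡-Reasoning
  inc = proj₁ bd
  a = leadingZeros d
  d₁ = drop a d
  w₁ = drop a w
  d≡ : replicate a 0 ++ d₁ ≡ d
  d≡ = leadingZeros-split d
  w≡ : replicate a 0 ++ w₁ ≡ w
  w≡ = Under-zeroBounds a d₁ w (subst (λ D → Under 0 D w) (sym d≡) u)
  pos : All (0 <_) d₁
  pos = Under-lowerBound (Under-noLeadingZero (Under-drop a inc) (leadingZeros-drop d))
  ψ-w₁ = ψ-inv (BoundedBy-drop a bd , pos) (Under-drop a u)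
  r = ψ d₁ w₁
  Under-r : Under 0 d (replicate a 0 ++ r)
  Under-r = Under-replicate⁺ a d r (proj₁ ψ-w₁) (subst (a ≤_) (sym (Under-length inc)) (leadingZeros≤length d))
  leadingZeros-r : leadingZeros (replicate a 0 ++ r) ≡ hits d w
  leadingZeros-r = begin
    leadingZeros (replicate a 0 ++ r)              ≡⟨ leadingZeros-++ a r ⟩
    a + leadingZeros r                             ≡⟨ cong (a +_) (proj₁ (proj₂ ψ-w₁)) ⟩
    a + hits d₁ w₁                                 ≡⟨ sym (hits-replicate-zeros a d₁ w₁) ⟩
    hits (replicate a 0 ++ d₁) (replicate a 0 ++ w₁) ≡⟨ cong₂ hits d≡ w≡ ⟩
    hits d w                                       ∎
  involutive : skipZeroBounds ψ d (replicate a 0 ++ r) ≡ w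
  involutive = begin
    replicate a 0 ++ ψ d₁ (drop a (replicate a 0 ++ r)) ≡⟨ cong (λ r′ → replicate a 0 ++ ψ d₁ r′) (drop-replicate-++ a {0} r) ⟩
    replicate a 0 ++ ψ d₁ r                            ≡⟨ cong (replicate a 0 ++_) (proj₂ (proj₂ ψ-w₁)) ⟩
    replicate a 0 ++ w₁                                ≡⟨ w≡ ⟩
    w                                                  ∎

Φ-zerosHitsInvolution : ∀ B → ZerosHitsInvolution (BoundedBy B) (Φ B)
Φ-zerosHitsInvolution zero    (_ , d≤0) u = u , leadingZeros≡hits-zeroBounds u d≤0 , refl
Φ-zerosHitsInvolution (suc B) =
  skipZeroBounds-zerosHitsInvolution (liftPositive-zerosHitsInvolution (Φ-zerosHitsInvolution B))

-- Paths as lists of blocks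

eastSteps : List Step → ℕ
eastSteps []      = 0
eastSteps (E ∷ s) = suc (eastSteps s)
eastSteps (N ∷ s) = eastSteps s

northSteps : List Step → ℕ
northSteps []      = 0
northSteps (E ∷ s) = northSteps s
northSteps (N ∷ s) = suc (northSteps s)

blocksPath : ℕ → ℕ → List ℕ → List ℕ → List Step
blocksPath m x (a ∷ α) (v ∷ vs) = replicate (v ∸ x) E ++ replicate a N ++ blocksPath m v α vs
blocksPath m x _       _        = replicate (m ∸ x) E

blockXsFrom : ℕ → Bool → List Step → List ℕ
blockXsFrom x _     []      = []
blockXsFrom x false (N ∷ s) = x ∷ blockXsFrom x true s
blockXsFrom x true  (N ∷ s) = blockXsFrom x true s
blockXsFrom x _     (E ∷ s) = blockXsFrom (suc x) false s

blockXs : List Step → List ℕ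
blockXs = blockXsFrom 0 false

data Blocks : ℕ → List ℕ → List ℕ → Set where
  []   : ∀ {x} → Blocks x [] []
  cons : ∀ {x v a α vs} → x ≤ v → Blocks (suc v) α vs → Blocks x (suc a ∷ α) (v ∷ vs)

Blocks-weaken : ∀ {x x′ α vs} → x′ ≤ x → Blocks x α vs → Blocks x′ α vs
Blocks-weaken x′≤x []             = []
Blocks-weaken x′≤x (cons x≤v bs) = cons (≤-trans x′≤x x≤v) bs

Blocks-positive : ∀ {x α vs} → Blocks x α vs → All (0 <_) α
Blocks-positive []          = []
Blocks-positive (cons _ bs) = s≤s z≤n ∷ Blocks-positive bs

mutual
  Blocks-blockXs : ∀ x s → Blocks x (compAux 0 s) (blockXsFrom x false s)
  Blocks-blockXs x []      = []
  Blocks-blockXs x (N ∷ s) = Blocks-blockXs-inBlock x 0 s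
  Blocks-blockXs x (E ∷ s) = Blocks-weaken (n≤1+n x) (Blocks-blockXs (suc x) s)

  Blocks-blockXs-inBlock : ∀ x c s → Blocks x (compAux (suc c) s) (x ∷ blockXsFrom x true s)
  Blocks-blockXs-inBlock x c []      = cons ≤-refl []
  Blocks-blockXs-inBlock x c (N ∷ s) = Blocks-blockXs-inBlock x (suc c) s
  Blocks-blockXs-inBlock x c (E ∷ s) = cons ≤-refl (Blocks-blockXs (suc x) s)

m<n⇒n∸m≡1+n∸1+m : ∀ {m n} → m < n → n ∸ m ≡ suc (n ∸ suc m)
m<n⇒n∸m≡1+n∸1+m (s≤s m≤n) = +-∸-assoc 1 m≤n

blocksPath-east : ∀ m x α vs → x < m → Blocks (suc x) α vs →
                  blocksPath m x α vs ≡ E ∷ blocksPath m (suc x) α vs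
blocksPath-east m x []      vs       x<m _            = cong (λ k → replicate k E) (m<n⇒n∸m≡1+n∸1+m x<m)
blocksPath-east m x (a ∷ α) []       x<m _            = cong (λ k → replicate k E) (m<n⇒n∸m≡1+n∸1+m x<m)
blocksPath-east m x (a ∷ α) (v ∷ vs) _   (cons x<v _) =
  cong (λ k → replicate k E ++ replicate a N ++ blocksPath m v α vs) (m<n⇒n∸m≡1+n∸1+m x<v)

replicate-N-snoc : ∀ c (s : List Step) → replicate c N ++ N ∷ s ≡ N ∷ replicate c N ++ s
replicate-N-snoc zero    s = refl
replicate-N-snoc (suc c) s = cong (N ∷_) (replicate-N-snoc c s)

mutual
  blocksPath-blockXs : ∀ m x s → x + eastSteps s ≡ m →
                       s ≡ blocksPath m x (compAux 0 s) (blockXsFrom x false s)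
  blocksPath-blockXs m x []      x≡m = cong (λ k → replicate k E) (sym (begin
    m ∸ x     ≡⟨ cong (_∸ x) (trans (sym x≡m) (+-identityʳ x)) ⟩
    x ∸ x     ≡⟨ n∸n≡0 x ⟩
    0         ∎))
    where open ≡-Reasoning
  blocksPath-blockXs m x (N ∷ s) x+e≡m = blocksPath-blockXs-inBlock m x 0 s x+e≡m
  blocksPath-blockXs m x (E ∷ s) x+e≡m = blocksPath-blockXs-east m x s x+e≡m

  blocksPath-blockXs-east : ∀ m x s → x + eastSteps (E ∷ s) ≡ m →
                            E ∷ s ≡ blocksPath m x (compAux 0 s) (blockXsFrom (suc x) false s)
  blocksPath-blockXs-east m x s x+e≡m =
    trans (cong (E ∷_) (blocksPath-blockXs m (suc x) s (trans (sym (+-suc x (eastSteps s))) x+e≡m)))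
          (sym (blocksPath-east m x (compAux 0 s) (blockXsFrom (suc x) false s) x<m (Blocks-blockXs (suc x) s)))
    where
    x<m : x < m
    x<m = subst (x <_) x+e≡m (m<m+n x (s≤s z≤n))

  blocksPath-blockXs-inBlock : ∀ m x c s → x + eastSteps s ≡ m →
    replicate (suc c) N ++ s ≡ blocksPath m x (compAux (suc c) s) (x ∷ blockXsFrom x true s)
  blocksPath-blockXs-inBlock m x c [] x≡m rewrite n∸n≡0 x | sym x≡m | +-identityʳ x | n∸n≡0 x = refl
  blocksPath-blockXs-inBlock m x c (N ∷ s) x+e≡m =
    trans (cong (N ∷_) (replicate-N-snoc c s)) (blocksPath-blockXs-inBlock m x (suc c) s x+e≡m)
  blocksPath-blockXs-inBlock m x c (E ∷ s) x+e≡m rewrite n∸n≡0 x =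
    cong (replicate (suc c) N ++_) (blocksPath-blockXs-east m x s x+e≡m)

data StartsEast : List Step → Set where
  []  : StartsEast []
  E∷_ : ∀ s → StartsEast (E ∷ s)

StartsEast-replicate : ∀ k → StartsEast (replicate k E)
StartsEast-replicate zero    = []
StartsEast-replicate (suc k) = E∷ _

StartsEast-blocksPath : ∀ m x α vs → Blocks (suc x) α vs → StartsEast (blocksPath m x α vs)
StartsEast-blocksPath m x []      vs       _            = StartsEast-replicate (m ∸ x)
StartsEast-blocksPath m x (a ∷ α) (v ∷ vs) (cons x<v _) rewrite m<n⇒n∸m≡1+n∸1+m x<v = E∷ _

compAux-startsEast : ∀ c {s} → StartsEast s → compAux (suc c) s ≡ suc c ∷ compAux 0 s
compAux-startsEast c []      = refl
compAux-startsEast c (E∷ s) = refl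

blockXsFrom-startsEast : ∀ x {s} → StartsEast s → blockXsFrom x true s ≡ blockXsFrom x false s
blockXsFrom-startsEast x []      = refl
blockXsFrom-startsEast x (E∷ s) = refl

compAux-east : ∀ k s → compAux 0 (replicate k E ++ s) ≡ compAux 0 s
compAux-east zero    s = refl
compAux-east (suc k) s = compAux-east k s

compAux-north : ∀ c a s → compAux c (replicate a N ++ s) ≡ compAux (c + a) s
compAux-north c       zero    s = cong (λ k → compAux k s) (sym (+-identityʳ c))
compAux-north zero    (suc a) s = compAux-north 1 a s
compAux-north (suc c) (suc a) s =
  trans (compAux-north (suc (suc c)) a s) (cong (λ k → compAux (suc k) s) (sym (+-suc c a)))

comp-blocksPath : ∀ m x α vs → Blocks x α vs → comp (blocksPath m x α vs) ≡ α
comp-blocksPath m x []          []       []           =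
  trans (cong comp (sym (++-identityʳ (replicate (m ∸ x) E)))) (compAux-east (m ∸ x) [])
comp-blocksPath m x (suc a ∷ α) (v ∷ vs) (cons x≤v bs) = begin
  compAux 0 (replicate (v ∸ x) E ++ replicate (suc a) N ++ rest) ≡⟨ compAux-east (v ∸ x) _ ⟩
  compAux 1 (replicate a N ++ rest)                             ≡⟨ compAux-north 1 a rest ⟩
  compAux (suc a) rest                                          ≡⟨ compAux-startsEast a (StartsEast-blocksPath m v α vs bs) ⟩
  suc a ∷ comp rest                                             ≡⟨ cong (suc a ∷_) (comp-blocksPath m v α vs (Blocks-weaken (n≤1+n v) bs)) ⟩
  suc a ∷ α                                                     ∎
  where
  open ≡-Reasoning
  rest = blocksPath m v α vs

blockXsFrom-east : ∀ x k s → blockXsFrom x false (replicate k E ++ s) ≡ blockXsFrom (x + k) false s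
blockXsFrom-east x zero    s = cong (λ y → blockXsFrom y false s) (sym (+-identityʳ x))
blockXsFrom-east x (suc k) s = trans (blockXsFrom-east (suc x) k s) (cong (λ y → blockXsFrom y false s) (sym (+-suc x k)))

blockXsFrom-north : ∀ x a s → blockXsFrom x true (replicate a N ++ s) ≡ blockXsFrom x true s
blockXsFrom-north x zero    s = refl
blockXsFrom-north x (suc a) s = blockXsFrom-north x a s

blockXs-blocksPath : ∀ m x α vs → Blocks x α vs → blockXsFrom x false (blocksPath m x α vs) ≡ vs
blockXs-blocksPath m x []          []       []            =
  trans (cong (blockXsFrom x false) (sym (++-identityʳ (replicate (m ∸ x) E)))) (blockXsFrom-east x (m ∸ x) [])
blockXs-blocksPath m x (suc a ∷ α) (v ∷ vs) (cons x≤v bs) = begin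
  blockXsFrom x false (replicate (v ∸ x) E ++ replicate (suc a) N ++ rest) ≡⟨ blockXsFrom-east x (v ∸ x) _ ⟩
  blockXsFrom (x + (v ∸ x)) false (replicate (suc a) N ++ rest)           ≡⟨ cong (λ y → blockXsFrom y false (replicate (suc a) N ++ rest)) (m+[n∸m]≡n x≤v) ⟩
  v ∷ blockXsFrom v true (replicate a N ++ rest)                           ≡⟨ cong (v ∷_) (blockXsFrom-north v a rest) ⟩
  v ∷ blockXsFrom v true rest                                              ≡⟨ cong (v ∷_) (blockXsFrom-startsEast v (StartsEast-blocksPath m v α vs bs)) ⟩
  v ∷ blockXsFrom v false rest                                             ≡⟨ cong (v ∷_) (blockXs-blocksPath m v α vs (Blocks-weaken (n≤1+n v) bs)) ⟩
  v ∷ vs                                                                   ∎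
  where
  open ≡-Reasoning
  rest = blocksPath m v α vs

eastSteps-east : ∀ k s → eastSteps (replicate k E ++ s) ≡ k + eastSteps s
eastSteps-east zero    s = refl
eastSteps-east (suc k) s = cong suc (eastSteps-east k s)

eastSteps-north : ∀ k s → eastSteps (replicate k N ++ s) ≡ eastSteps s
eastSteps-north zero    s = refl
eastSteps-north (suc k) s = eastSteps-north k s

northSteps-east : ∀ k s → northSteps (replicate k E ++ s) ≡ northSteps s
northSteps-east zero    s = refl
northSteps-east (suc k) s = northSteps-east k s

northSteps-north : ∀ k s → northSteps (replicate k N ++ s) ≡ k + northSteps s
northSteps-north zero    s = refl
northSteps-north (suc k) s = cong suc (northSteps-north k s)

eastSteps-replicate : ∀ k → eastSteps (replicate k E) ≡ k
eastSteps-replicate k = trans (cong eastSteps (sym (++-identityʳ (replicate k E)))) (trans (eastSteps-east k []) (+-identityʳ k))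

northSteps-replicate : ∀ k → northSteps (replicate k E) ≡ 0
northSteps-replicate k = trans (cong northSteps (sym (++-identityʳ (replicate k E)))) (northSteps-east k [])

northSteps-blocksPath : ∀ m x α vs → Blocks x α vs → northSteps (blocksPath m x α vs) ≡ sum α
northSteps-blocksPath m x []      []       []          = northSteps-replicate (m ∸ x)
northSteps-blocksPath m x (a ∷ α) (v ∷ vs) (cons _ bs) = begin
  northSteps (replicate (v ∸ x) E ++ replicate a N ++ rest) ≡⟨ northSteps-east (v ∸ x) _ ⟩
  northSteps (replicate a N ++ rest)                        ≡⟨ northSteps-north a rest ⟩
  a + northSteps rest                                       ≡⟨ cong (a +_) (northSteps-blocksPath m v α vs (Blocks-weaken (n≤1+n v) bs)) ⟩
  a + sum α                                                 ∎
  where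
  open ≡-Reasoning
  rest = blocksPath m v α vs

eastSteps-blocksPath : ∀ m x α vs → Blocks x α vs → x ≤ m → All (_≤ m) vs →
                       x + eastSteps (blocksPath m x α vs) ≡ m
eastSteps-blocksPath m x []      []       []           x≤m _ = trans (cong (x +_) (eastSteps-replicate (m ∸ x))) (m+[n∸m]≡n x≤m)
eastSteps-blocksPath m x (a ∷ α) (v ∷ vs) (cons x≤v bs) _ (v≤m ∷ vs≤m) = begin
  x + eastSteps (replicate (v ∸ x) E ++ replicate a N ++ rest) ≡⟨ cong (x +_) (eastSteps-east (v ∸ x) _) ⟩
  x + ((v ∸ x) + eastSteps (replicate a N ++ rest))            ≡⟨ sym (+-assoc x (v ∸ x) _) ⟩
  x + (v ∸ x) + eastSteps (replicate a N ++ rest)              ≡⟨ cong₂ _+_ (m+[n∸m]≡n x≤v) (eastSteps-north a rest) ⟩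
  v + eastSteps rest                                           ≡⟨ eastSteps-blocksPath m v α vs (Blocks-weaken (n≤1+n v) bs) v≤m vs≤m ⟩
  m                                                            ∎
  where
  open ≡-Reasoning
  rest = blocksPath m v α vs

module _ (m n : ℕ) where

  aboveFrom-start : ∀ x y s → aboveFrom m n x y s ≡ true → n * x ≤ m * y
  aboveFrom-start x y []      above = ⌊⌋-sound (n * x ≤? m * y) above
  aboveFrom-start x y (N ∷ s) above = ⌊⌋-sound (n * x ≤? m * y) (proj₁ (∧-true⁻ above))
  aboveFrom-start x y (E ∷ s) above = ⌊⌋-sound (n * x ≤? m * y) (proj₁ (∧-true⁻ above))

  aboveFrom-east : ∀ x y s → aboveFrom m n x y (E ∷ s) ≡ aboveFrom m n (suc x) y s
  aboveFrom-east x y s with aboveFrom m n (suc x) y s in above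
  ... | true  = cong (_∧ true) (⌊⌋-true (n * x ≤? m * y)
                  (≤-trans (*-monoʳ-≤ n (n≤1+n x)) (aboveFrom-start (suc x) y s above)))
  ... | false = ∧-zeroʳ _

  aboveFrom-eastRun : ∀ x y k s → aboveFrom m n x y (replicate k E ++ s) ≡ aboveFrom m n (x + k) y s
  aboveFrom-eastRun x y zero    s = cong (λ x′ → aboveFrom m n x′ y s) (sym (+-identityʳ x))
  aboveFrom-eastRun x y (suc k) s =
    trans (aboveFrom-east x y (replicate k E ++ s))
          (trans (aboveFrom-eastRun (suc x) y k s) (cong (λ x′ → aboveFrom m n x′ y s) (sym (+-suc x k))))

  aboveFrom-northRun⁻ : ∀ x y a s → aboveFrom m n x y (replicate a N ++ s) ≡ true → aboveFrom m n x (y + a) s ≡ true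
  aboveFrom-northRun⁻ x y zero    s above = subst (λ y′ → aboveFrom m n x y′ s ≡ true) (sym (+-identityʳ y)) above
  aboveFrom-northRun⁻ x y (suc a) s above = subst (λ y′ → aboveFrom m n x y′ s ≡ true) (sym (+-suc y a))
    (aboveFrom-northRun⁻ x (suc y) a s (proj₂ (∧-true⁻ above)))

  aboveFrom-northRun⁺ : ∀ x y a s → n * x ≤ m * y → aboveFrom m n x (y + a) s ≡ true →
                        aboveFrom m n x y (replicate a N ++ s) ≡ true
  aboveFrom-northRun⁺ x y zero    s _     above = subst (λ y′ → aboveFrom m n x y′ s ≡ true) (+-identityʳ y) above
  aboveFrom-northRun⁺ x y (suc a) s start above = cong₂ _∧_ (⌊⌋-true (n * x ≤? m * y) start)
    (aboveFrom-northRun⁺ x (suc y) a s (≤-trans start (*-monoʳ-≤ m (n≤1+n y)))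
      (subst (λ y′ → aboveFrom m n x y′ s ≡ true) (+-suc y a) above))

  data BlocksAbove : ℕ → List ℕ → List ℕ → Set where
    []   : ∀ {S} → BlocksAbove S [] []
    cons : ∀ {S a α v vs} → n * v ≤ m * S → BlocksAbove (S + a) α vs → BlocksAbove S (a ∷ α) (v ∷ vs)

  aboveFrom-blocksPath-cons : ∀ x S a α v vs → x ≤ v →
    aboveFrom m n x S (blocksPath m x (a ∷ α) (v ∷ vs)) ≡ aboveFrom m n v S (replicate a N ++ blocksPath m v α vs)
  aboveFrom-blocksPath-cons x S a α v vs x≤v =
    trans (aboveFrom-eastRun x S (v ∸ x) column) (cong (λ x′ → aboveFrom m n x′ S column) (m+[n∸m]≡n x≤v))
    where column = replicate a N ++ blocksPath m v α vs

  BlocksAbove-aboveFrom : ∀ x S α vs → Blocks x α vs → aboveFrom m n x S (blocksPath m x α vs) ≡ true →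
                          BlocksAbove S α vs
  BlocksAbove-aboveFrom x S []      []       []            _     = []
  BlocksAbove-aboveFrom x S (a ∷ α) (v ∷ vs) (cons x≤v bs) above =
    cons (aboveFrom-start v S (replicate a N ++ blocksPath m v α vs) above′)
         (BlocksAbove-aboveFrom v (S + a) α vs (Blocks-weaken (n≤1+n v) bs) (aboveFrom-northRun⁻ v S a (blocksPath m v α vs) above′))
    where above′ = trans (sym (aboveFrom-blocksPath-cons x S a α v vs x≤v)) above

  aboveFrom-BlocksAbove : ∀ x S α vs → Blocks x α vs → BlocksAbove S α vs → S + sum α ≡ n → x ≤ m → All (_≤ m) vs →
                          aboveFrom m n x S (blocksPath m x α vs) ≡ true
  aboveFrom-BlocksAbove x S [] [] [] [] S≡n x≤m [] = begin
    aboveFrom m n x S (replicate (m ∸ x) E)      ≡⟨ cong (aboveFrom m n x S) (sym (++-identityʳ (replicate (m ∸ x) E))) ⟩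
    aboveFrom m n x S (replicate (m ∸ x) E ++ []) ≡⟨ aboveFrom-eastRun x S (m ∸ x) [] ⟩
    ⌊ n * (x + (m ∸ x)) ≤? m * S ⌋               ≡⟨ ⌊⌋-true (n * (x + (m ∸ x)) ≤? m * S) endAbove ⟩
    true                                         ∎
    where
    open ≡-Reasoning
    endAbove : n * (x + (m ∸ x)) ≤ m * S
    endAbove = subst₂ (λ x′ S′ → n * x′ ≤ m * S′) (sym (m+[n∸m]≡n x≤m)) (trans (sym S≡n) (+-identityʳ S))
                      (≤-reflexive (*-comm n m))
  aboveFrom-BlocksAbove x S (a ∷ α) (v ∷ vs) (cons x≤v bs) (cons start ba) S≡n _ (v≤m ∷ vs≤m) =
    trans (aboveFrom-blocksPath-cons x S a α v vs x≤v)
          (aboveFrom-northRun⁺ v S a (blocksPath m v α vs) start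
            (aboveFrom-BlocksAbove v (S + a) α vs (Blocks-weaken (n≤1+n v) bs) ba
              (trans (+-assoc S a (sum α)) S≡n) v≤m vs≤m))

  BlocksAbove-≤ : ∀ {S α vs} → 0 < n → BlocksAbove S α vs → S + sum α ≡ n → All (_≤ m) vs
  BlocksAbove-≤ _   []                              _   = []
  BlocksAbove-≤ 0<n (cons {S} {a} {α} {v} nv≤mS ba) S≡n =
    *-cancelˡ-≤ n {{>-nonZero 0<n}} (begin
      n * v ≤⟨ nv≤mS ⟩
      m * S ≤⟨ *-monoʳ-≤ m S≤n ⟩
      m * n ≡⟨ *-comm m n ⟩
      n * m ∎)
    ∷ BlocksAbove-≤ 0<n ba (trans (+-assoc S a (sum α)) S≡n)
    where
    open ≤-Reasoning
    S≤n : S ≤ n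
    S≤n = subst (S ≤_) S≡n (m≤m+n S (a + sum α))

memb-replicate : ∀ i v a r → memb i (replicate (suc a) v ++ r) ≡ memb i (v ∷ r)
memb-replicate i v zero    r = refl
memb-replicate i v (suc a) r =
  trans (cong (λ b → if ⌊ i ≟ v ⌋ then true else b) (memb-replicate i v a r)) (if-idem ⌊ i ≟ v ⌋)
  where
  if-idem : ∀ b → (if b then true else (if b then true else memb i r)) ≡ (if b then true else memb i r)
  if-idem true  = refl
  if-idem false = refl

memb-cons : ∀ i v r → memb i r ≡ true → memb i (v ∷ r) ≡ true
memb-cons i v r i∈r with ⌊ i ≟ v ⌋
... | true  = refl
... | false = i∈r

northXsFrom-east : ∀ x k s → northXsFrom x (replicate k E ++ s) ≡ northXsFrom (x + k) s
northXsFrom-east x zero    s = cong (λ x′ → northXsFrom x′ s) (sym (+-identityʳ x))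
northXsFrom-east x (suc k) s = trans (northXsFrom-east (suc x) k s) (cong (λ x′ → northXsFrom x′ s) (sym (+-suc x k)))

northXsFrom-north : ∀ x a s → northXsFrom x (replicate a N ++ s) ≡ replicate a x ++ northXsFrom x s
northXsFrom-north x zero    s = refl
northXsFrom-north x (suc a) s = cong (x ∷_) (northXsFrom-north x a s)

memb-northXs-blocksPath : ∀ m x α vs → Blocks x α vs → ∀ i → memb i (northXsFrom x (blocksPath m x α vs)) ≡ memb i vs
memb-northXs-blocksPath m x [] [] [] i =
  cong (memb i) (trans (cong (northXsFrom x) (sym (++-identityʳ (replicate (m ∸ x) E)))) (northXsFrom-east x (m ∸ x) []))
memb-northXs-blocksPath m x (suc a ∷ α) (v ∷ vs) (cons x≤v bs) i = begin
  memb i (northXsFrom x (replicate (v ∸ x) E ++ replicate (suc a) N ++ rest))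
    ≡⟨ cong (memb i) (northXsFrom-east x (v ∸ x) _) ⟩
  memb i (northXsFrom (x + (v ∸ x)) (replicate (suc a) N ++ rest))
    ≡⟨ cong (λ x′ → memb i (northXsFrom x′ (replicate (suc a) N ++ rest))) (m+[n∸m]≡n x≤v) ⟩
  memb i (northXsFrom v (replicate (suc a) N ++ rest))
    ≡⟨ cong (memb i) (northXsFrom-north v (suc a) rest) ⟩
  memb i (replicate (suc a) v ++ northXsFrom v rest)
    ≡⟨ memb-replicate i v a _ ⟩
  (if ⌊ i ≟ v ⌋ then true else memb i (northXsFrom v rest))
    ≡⟨ cong (λ b → if ⌊ i ≟ v ⌋ then true else b) (memb-northXs-blocksPath m v α vs (Blocks-weaken (n≤1+n v) bs) i) ⟩
  memb i (v ∷ vs) ∎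
  where
  open ≡-Reasoning
  rest = blocksPath m v α vs

firstMissing-cong : ∀ j k us us′ → (∀ i → memb i us ≡ memb i us′) → firstMissing j k us ≡ firstMissing j k us′
firstMissing-cong j zero    us us′ _    = refl
firstMissing-cong j (suc k) us us′ same rewrite same j | firstMissing-cong (suc j) k us us′ same = refl

firstMissing-≡ : ∀ c j k us → (∀ i → i < c → memb (j + i) us ≡ true) → memb (j + c) us ≡ false → c ≤ k →
                 firstMissing j k us ≡ j + c
firstMissing-≡ zero    j zero    us _       _      _ = sym (+-identityʳ j)
firstMissing-≡ zero    j (suc k) us _       j∉us   _ rewrite +-identityʳ j | j∉us = refl
firstMissing-≡ (suc c) j (suc k) us present absent (s≤s c≤k)
  rewrite subst (λ i → memb i us ≡ true) (+-identityʳ j) (present 0 z<s) =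
  trans (firstMissing-≡ c (suc j) k us
           (λ i i<c → subst (λ i′ → memb i′ us ≡ true) (+-suc j i) (present (suc i) (s≤s i<c)))
           (subst (λ i′ → memb i′ us ≡ false) (+-suc j c) absent) c≤k)
        (sym (+-suc j c))

addIndices : ℕ → List ℕ → List ℕ
addIndices j []      = []
addIndices j (x ∷ w) = x + j ∷ addIndices (suc j) w

subIndices : ℕ → List ℕ → List ℕ
subIndices j []      = []
subIndices j (v ∷ vs) = v ∸ j ∷ subIndices (suc j) vs

addIndices-subIndices : ∀ {j α vs} → Blocks j α vs → addIndices j (subIndices j vs) ≡ vs
addIndices-subIndices []            = refl
addIndices-subIndices (cons j≤v bs) = cong₂ _∷_ (m∸n+n≡m j≤v) (addIndices-subIndices (Blocks-weaken (s≤s j≤v) bs))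

subIndices-addIndices : ∀ j w → subIndices j (addIndices j w) ≡ w
subIndices-addIndices j []      = refl
subIndices-addIndices j (x ∷ w) = cong₂ _∷_ (m+n∸n≡m x j) (subIndices-addIndices (suc j) w)

memb-addIndices-leadingZeros : ∀ j w i → i < leadingZeros w → memb (j + i) (addIndices j w) ≡ true
memb-addIndices-leadingZeros j (zero ∷ w) zero    _ rewrite ⌊⌋-true (j + 0 ≟ j) (+-identityʳ j) = refl
memb-addIndices-leadingZeros j (zero ∷ w) (suc i) (s≤s i<) =
  memb-cons (j + suc i) j (addIndices (suc j) w)
    (subst (λ i′ → memb i′ (addIndices (suc j) w) ≡ true) (sym (+-suc j i)) (memb-addIndices-leadingZeros (suc j) w i i<))

memb-addIndices-below : ∀ {lo d w} → Under lo d w → ∀ j i → i < lo + j → memb i (addIndices j w) ≡ false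
memb-addIndices-below []                         j i _ = refl
memb-addIndices-below (cons {x = x} lo≤x _ u) j i i<lo+j
  with i<x+j ← ≤-trans i<lo+j (+-monoˡ-≤ j lo≤x)
  rewrite ⌊⌋-false (i ≟ x + j) (<⇒≢ i<x+j) =
  memb-addIndices-below u (suc j) i (subst (i <_) (sym (+-suc x j)) (m<n⇒m<1+n i<x+j))

memb-addIndices-afterZeros : ∀ {lo d w} → Under lo d w → ∀ j → memb (j + leadingZeros w) (addIndices j w) ≡ false
memb-addIndices-afterZeros [] j = refl
memb-addIndices-afterZeros (cons {x = zero} {w = w} _ _ u) j
  rewrite ⌊⌋-false (j + suc (leadingZeros w) ≟ j) (m+1+n≢m j) =
  subst (λ i → memb i (addIndices (suc j) w) ≡ false) (sym (+-suc j (leadingZeros w)))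
        (memb-addIndices-afterZeros u (suc j))
memb-addIndices-afterZeros (cons {x = suc y} _ y<e u) j =
  memb-addIndices-below (cons ≤-refl y<e u) j (j + 0) (subst (_< suc y + j) (sym (+-identityʳ j)) (s≤s (m≤n+m j y)))

run-blocksPath : ∀ m n α w {d} → Blocks 0 α (addIndices 0 (0 ∷ w)) → Under 0 d (0 ∷ w) → suc (leadingZeros w) ≤ n →
                 run n (blocksPath m 0 α (addIndices 0 (0 ∷ w))) ≡ suc (leadingZeros w)
run-blocksPath m n α w bs u lz<n = begin
  firstMissing 1 n (northXsFrom 0 (blocksPath m 0 α vs)) ≡⟨ firstMissing-cong 1 n _ _ (memb-northXs-blocksPath m 0 α vs bs) ⟩
  firstMissing 1 n vs                                    ≡⟨ firstMissing-≡ (leadingZeros w) 1 n vs present absent (≤-trans (n≤1+n _) lz<n) ⟩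
  suc (leadingZeros w)                                   ∎
  where
  open ≡-Reasoning
  vs = addIndices 0 (0 ∷ w)
  present : ∀ i → i < leadingZeros w → memb (suc i) vs ≡ true
  present i i< = memb-addIndices-leadingZeros 0 (0 ∷ w) (suc i) (s≤s i<)
  absent : memb (suc (leadingZeros w)) vs ≡ false
  absent = memb-addIndices-afterZeros u 0

module _ (m n : ℕ) where

  retFrom-east : ∀ i j k s → retFrom m n i j (replicate k E ++ s) ≡ retFrom m n (i + k) j s
  retFrom-east i j zero    s = cong (λ i′ → retFrom m n i′ j s) (sym (+-identityʳ i))
  retFrom-east i j (suc k) s = trans (retFrom-east (suc i) j k s) (cong (λ i′ → retFrom m n i′ j s) (sym (+-suc i k)))

  retFrom-north-high : ∀ i j a s → i * n + n ≤ j * m → retFrom m n i j (replicate a N ++ s) ≡ retFrom m n i (j + a) s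
  retFrom-north-high i j zero    s _    = cong (λ j′ → retFrom m n i j′ s) (sym (+-identityʳ j))
  retFrom-north-high i j (suc a) s high rewrite ⌊⌋-false (j * m <? i * n + n) (≤⇒≯ high) =
    trans (retFrom-north-high i (suc j) a s (≤-trans high (m≤n+m (j * m) m)))
          (cong (λ j′ → retFrom m n i j′ s) (sym (+-suc j a)))

  touchingBlocks : ℕ → List ℕ → List ℕ → ℕ
  touchingBlocks S (a ∷ α) (v ∷ vs) = (if ⌊ S * m <? v * n + n ⌋ then 1 else 0) + touchingBlocks (S + a) α vs
  touchingBlocks S _       _        = 0

  retFrom-blocksPath : ∀ x S α vs → Blocks x α vs → BlocksAbove m n S α vs → n ≤ m →
                       retFrom m n x S (blocksPath m x α vs) ≡ touchingBlocks S α vs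
  retFrom-blocksPath x S []          []       []            []              _   =
    trans (cong (retFrom m n x S) (sym (++-identityʳ (replicate (m ∸ x) E)))) (retFrom-east x S (m ∸ x) [])
  retFrom-blocksPath x S (suc a ∷ α) (v ∷ vs) (cons x≤v bs) (cons nv≤mS ba) n≤m = begin
    retFrom m n x S (replicate (v ∸ x) E ++ replicate (suc a) N ++ rest)
      ≡⟨ retFrom-east x S (v ∸ x) _ ⟩
    retFrom m n (x + (v ∸ x)) S (replicate (suc a) N ++ rest)
      ≡⟨ cong (λ x′ → retFrom m n x′ S (replicate (suc a) N ++ rest)) (m+[n∸m]≡n x≤v) ⟩
    first + retFrom m n v (suc S) (replicate a N ++ rest)
      ≡⟨ cong (first +_) (retFrom-north-high v (suc S) a rest high) ⟩
    first + retFrom m n v (suc S + a) rest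
      ≡⟨ cong (λ S′ → first + retFrom m n v S′ rest) (sym (+-suc S a)) ⟩
    first + retFrom m n v (S + suc a) rest
      ≡⟨ cong (first +_) (retFrom-blocksPath v (S + suc a) α vs (Blocks-weaken (n≤1+n v) bs) ba n≤m) ⟩
    first + touchingBlocks (S + suc a) α vs ∎
    where
    open ≡-Reasoning
    rest = blocksPath m v α vs
    first = if ⌊ S * m <? v * n + n ⌋ then 1 else 0
    high : v * n + n ≤ suc S * m
    high = subst₂ (λ vn Sm → vn + n ≤ Sm) (*-comm n v) (trans (cong (_+ m) (*-comm m S)) (+-comm (S * m) m))
                  (+-mono-≤ nv≤mS n≤m)

-- Block abscissae as a bounded sequence

module _ {n : ℕ} .{{_ : NonZero n}} where

  m*n≤o⇒m≤o/n : ∀ m o → m * n ≤ o → m ≤ o / n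
  m*n≤o⇒m≤o/n m o m*n≤o = subst (_≤ o / n) (m*n/n≡m m n) (/-monoˡ-≤ n m*n≤o)

  m≤o/n⇒m*n≤o : ∀ m o → m ≤ o / n → m * n ≤ o
  m≤o/n⇒m*n≤o m o m≤o/n = ≤-trans (*-monoˡ-≤ n m≤o/n) (m/n*n≤m o n)

  m<[1+m/n]*n : ∀ m → m < suc (m / n) * n
  m<[1+m/n]*n m = subst (_< suc (m / n) * n) (sym (m≡m%n+[m/n]*n m n)) (+-monoˡ-< (m / n * n) (m%n<n m n))

blockBounds : (m n : ℕ) .{{_ : NonZero n}} → ℕ → ℕ → List ℕ → List ℕ
blockBounds m n S j []      = []
blockBounds m n S j (a ∷ α) = m * S / n ∸ j ∷ blockBounds m n (S + a) (suc j) α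

length-blockBounds : ∀ m n .{{_ : NonZero n}} S j α → length (blockBounds m n S j α) ≡ length α
length-blockBounds m n S j []      = refl
length-blockBounds m n S j (a ∷ α) = cong suc (length-blockBounds m n (S + a) (suc j) α)

length≤sum : ∀ {α} → All (0 <_) α → length α ≤ sum α
length≤sum []        = z≤n
length≤sum (a>0 ∷ pos) = +-mono-≤ a>0 (length≤sum pos)

module _ (m n : ℕ) .{{_ : NonZero n}} (n≤m : n ≤ m) where

  j≤S⇒j≤mS/n : ∀ {j S} → j ≤ S → j ≤ m * S / n
  j≤S⇒j≤mS/n {j} {S} j≤S = ≤-trans j≤S (m*n≤o⇒m≤o/n S (m * S) (subst (S * n ≤_) (*-comm S m) (*-monoʳ-≤ S n≤m)))

  above⇒≤blockBound : ∀ x j S → n * (x + j) ≤ m * S → x ≤ m * S / n ∸ j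
  above⇒≤blockBound x j S above = m+n≤o⇒m≤o∸n x (m*n≤o⇒m≤o/n (x + j) (m * S) (subst (_≤ m * S) (*-comm n (x + j)) above))

  ≤blockBound⇒above : ∀ x j S → j ≤ S → x ≤ m * S / n ∸ j → n * (x + j) ≤ m * S
  ≤blockBound⇒above x j S j≤S x≤ = subst (_≤ m * S) (*-comm (x + j) n)
    (m≤o/n⇒m*n≤o (x + j) (m * S) (subst (x + j ≤_) (m∸n+n≡m (j≤S⇒j≤mS/n j≤S)) (+-monoˡ-≤ j x≤)))

  1+j≤S+1+a : ∀ {j S} a → j ≤ S → suc j ≤ S + suc a
  1+j≤S+1+a {j} {S} a j≤S = ≤-trans (s≤s j≤S) (subst (suc S ≤_) (sym (+-suc S a)) (s≤s (m≤m+n S a)))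

  Under⇒Blocks : ∀ lo S j α w → j ≤ S → All (0 <_) α → Under lo (blockBounds m n S j α) w →
                 Blocks (lo + j) α (addIndices j w) × BlocksAbove m n S α (addIndices j w)
  Under⇒Blocks lo S j []          []      _   _         []                 = [] , []
  Under⇒Blocks lo S j (suc a ∷ α) (x ∷ w) j≤S (_ ∷ pos) (cons lo≤x x≤ u) =
    cons (+-monoˡ-≤ j lo≤x) (subst (λ x′ → Blocks x′ α (addIndices (suc j) w)) (+-suc x j) (proj₁ rest)) ,
    cons (≤blockBound⇒above x j S j≤S x≤) (proj₂ rest)
    where rest = Under⇒Blocks x (S + suc a) (suc j) α w (1+j≤S+1+a a j≤S) pos u

  Blocks⇒Under : ∀ lo S j α w → j ≤ S → Blocks (lo + j) α (addIndices j w) → BlocksAbove m n S α (addIndices j w) →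
                 Under lo (blockBounds m n S j α) w
  Blocks⇒Under lo S j []          []      _   []             []              = []
  Blocks⇒Under lo S j (suc a ∷ α) (x ∷ w) j≤S (cons lo+j≤ bs) (cons above ba) =
    cons (+-cancelʳ-≤ j lo x lo+j≤) (above⇒≤blockBound x j S above)
         (Blocks⇒Under x (S + suc a) (suc j) α w (1+j≤S+1+a a j≤S)
           (subst (λ x′ → Blocks x′ α (addIndices (suc j) w)) (sym (+-suc x j)) bs) ba)

  blockBounds-increasing : ∀ lo S j α → lo ≤ m * S / n ∸ j → All (0 <_) α →
                           Under lo (blockBounds m n S j α) (blockBounds m n S j α)
  blockBounds-increasing lo S j []          _   _         = []
  blockBounds-increasing lo S j (suc a ∷ α) lo≤ (_ ∷ pos) =
    cons lo≤ ≤-refl (blockBounds-increasing (m * S / n ∸ j) (S + suc a) (suc j) α next pos)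
    where
    bound+1 : suc (m * S / n) * n ≤ m * (S + suc a)
    bound+1 = begin
      n + m * S / n * n ≤⟨ +-monoʳ-≤ n (m/n*n≤m (m * S) n) ⟩
      n + m * S         ≤⟨ +-monoˡ-≤ (m * S) n≤m ⟩
      m + m * S         ≤⟨ +-monoˡ-≤ (m * S) (subst (_≤ m * suc a) (*-identityʳ m) (*-monoʳ-≤ m (s≤s z≤n))) ⟩
      m * suc a + m * S ≡⟨ +-comm (m * suc a) (m * S) ⟩
      m * S + m * suc a ≡⟨ sym (*-distribˡ-+ m S (suc a)) ⟩
      m * (S + suc a)   ∎
      where open ≤-Reasoning
    next : m * S / n ∸ j ≤ m * (S + suc a) / n ∸ suc j
    next = ∸-monoˡ-≤ (suc j) (m*n≤o⇒m≤o/n (suc (m * S / n)) (m * (S + suc a)) bound+1)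

  touches≡onBound : ∀ x j S → j ≤ S → x ≤ m * S / n ∸ j →
                    ⌊ S * m <? (x + j) * n + n ⌋ ≡ ⌊ x ≟ m * S / n ∸ j ⌋
  touches≡onBound x j S j≤S x≤ with x ≟ m * S / n ∸ j
  ... | yes x≡ = ⌊⌋-true (S * m <? (x + j) * n + n)
    (subst₂ _<_ (*-comm m S) (trans (+-comm n (m * S / n * n)) (cong (λ y → y * n + n) (sym x+j≡))) (m<[1+m/n]*n (m * S)))
    where
    x+j≡ : x + j ≡ m * S / n
    x+j≡ = trans (cong (_+ j) x≡) (m∸n+n≡m (j≤S⇒j≤mS/n j≤S))
  ... | no x≢ = ⌊⌋-false (S * m <? (x + j) * n + n)
    (λ lt → <⇒≱ lt (subst₂ _≤_ (+-comm n ((x + j) * n)) (*-comm m S) (m≤o/n⇒m*n≤o (suc (x + j)) (m * S) x+j<)))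
    where
    x+j< : suc (x + j) ≤ m * S / n
    x+j< = subst (suc (x + j) ≤_) (m∸n+n≡m (j≤S⇒j≤mS/n j≤S)) (+-monoˡ-≤ j (≤∧≢⇒< x≤ x≢))

  touchingBlocks≡hits : ∀ lo S j α w → j ≤ S → All (0 <_) α → Under lo (blockBounds m n S j α) w →
                        touchingBlocks m n S α (addIndices j w) ≡ hits (blockBounds m n S j α) w
  touchingBlocks≡hits lo S j []          []      _   _         []               = refl
  touchingBlocks≡hits lo S j (suc a ∷ α) (x ∷ w) j≤S (_ ∷ pos) (cons _ x≤ u) =
    cong₂ (λ b r → (if b then 1 else 0) + r) (touches≡onBound x j S j≤S x≤)
          (touchingBlocks≡hits x (S + suc a) (suc j) α w (1+j≤S+1+a a j≤S) pos u)

∈-lattice⁻ : ∀ e k {P} → P ∈ lattice e k → eastSteps P ≡ e × northSteps P ≡ k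
∈-lattice⁻ zero    zero    (here refl) = refl , refl
∈-lattice⁻ zero    (suc k) P∈ with _ , P′∈ , refl ← ∈-map⁻ (N ∷_) P∈ =
  let e≡ , k≡ = ∈-lattice⁻ zero k P′∈ in e≡ , cong suc k≡
∈-lattice⁻ (suc e) zero    P∈ with _ , P′∈ , refl ← ∈-map⁻ (E ∷_) P∈ =
  let e≡ , k≡ = ∈-lattice⁻ e zero P′∈ in cong suc e≡ , k≡
∈-lattice⁻ (suc e) (suc k) P∈ with ∈-++⁻ (map (N ∷_) (lattice (suc e) k)) P∈
... | inj₁ P∈N with _ , P′∈ , refl ← ∈-map⁻ (N ∷_) P∈N =
  let e≡ , k≡ = ∈-lattice⁻ (suc e) k P′∈ in e≡ , cong suc k≡
... | inj₂ P∈E with _ , P′∈ , refl ← ∈-map⁻ (E ∷_) P∈E =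
  let e≡ , k≡ = ∈-lattice⁻ e (suc k) P′∈ in cong suc e≡ , k≡

∈-lattice⁺ : ∀ P {e k} → eastSteps P ≡ e → northSteps P ≡ k → P ∈ lattice e k
∈-lattice⁺ []      {zero}  {zero}  refl refl = here refl
∈-lattice⁺ (N ∷ P) {zero}  {suc k} e≡ k≡ = ∈-map⁺ (N ∷_) (∈-lattice⁺ P e≡ (suc-injective k≡))
∈-lattice⁺ (N ∷ P) {suc e} {suc k} e≡ k≡ = ∈-++⁺ˡ (∈-map⁺ (N ∷_) (∈-lattice⁺ P e≡ (suc-injective k≡)))
∈-lattice⁺ (E ∷ P) {suc e} {zero}  e≡ k≡ = ∈-map⁺ (E ∷_) (∈-lattice⁺ P (suc-injective e≡) k≡)
∈-lattice⁺ (E ∷ P) {suc e} {suc k} e≡ k≡ =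
  ∈-++⁺ʳ (map (N ∷_) (lattice (suc e) k)) (∈-map⁺ (E ∷_) (∈-lattice⁺ P (suc-injective e≡) k≡))

lattice-unique : ∀ e k → Unique (lattice e k)
lattice-unique zero    zero    = [] ∷ []
lattice-unique zero    (suc k) = Unique.map⁺ ∷-injectiveʳ (lattice-unique zero k)
lattice-unique (suc e) zero    = Unique.map⁺ ∷-injectiveʳ (lattice-unique e zero)
lattice-unique (suc e) (suc k) =
  Unique.++⁺ (Unique.map⁺ ∷-injectiveʳ (lattice-unique (suc e) k)) (Unique.map⁺ ∷-injectiveʳ (lattice-unique e (suc k))) disjoint
  where
  disjoint : ∀ {P} → P ∈ map (N ∷_) (lattice (suc e) k) × P ∈ map (E ∷_) (lattice e (suc k)) → ⊥
  disjoint (P∈N , P∈E) with _ , _ , refl ← ∈-map⁻ (N ∷_) P∈N | _ , _ , () ← ∈-map⁻ (E ∷_) P∈E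


-- The involution on rational Dyck paths

module _ (m n : ℕ) .{{_ : NonZero n}} (n≤m : n ≤ m) where

  bounds : List ℕ → List ℕ
  bounds = blockBounds m n 0 0

  path : List ℕ → List ℕ → List Step
  path α w = blocksPath m 0 α (addIndices 0 w)

  shiftedBlockXs : List Step → List ℕ
  shiftedBlockXs P = subIndices 0 (blockXs P)

  Admissible : List ℕ → List ℕ → Set
  Admissible α w = IsComposition n α × Under 0 (bounds α) w

  Admissible⇒Blocks : ∀ {α w} → Admissible α w → Blocks 0 α (addIndices 0 w) × BlocksAbove m n 0 α (addIndices 0 w)
  Admissible⇒Blocks {α} {w} ((pos , _) , u) = Under⇒Blocks m n n≤m 0 0 0 α w z≤n pos u

  comp-path : ∀ {α w} → Admissible α w → comp (path α w) ≡ α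
  comp-path {α} adm = comp-blocksPath m 0 α _ (proj₁ (Admissible⇒Blocks adm))

  above? : Decidable (λ P → aboveFrom m n 0 0 P ≡ true)
  above? P = aboveFrom m n 0 0 P ≟ᵇ true

  path∈D : ∀ {α w} → Admissible α w → path α w ∈ D m n
  path∈D {α} {w} adm@((_ , sum≡n) , _) = ∈-filter⁺ above? (∈-lattice⁺ (path α w) east north) above
    where
    bs = proj₁ (Admissible⇒Blocks adm)
    ba = proj₂ (Admissible⇒Blocks adm)
    xs≤m = BlocksAbove-≤ m n (>-nonZero⁻¹ n) ba sum≡n
    east = eastSteps-blocksPath m 0 α (addIndices 0 w) bs z≤n xs≤m
    north = trans (northSteps-blocksPath m 0 α (addIndices 0 w) bs) sum≡n
    above = aboveFrom-BlocksAbove m n 0 0 α (addIndices 0 w) bs ba sum≡n z≤n xs≤m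

  ret-path : ∀ {α w} → Admissible α w → ret m n (path α w) ≡ hits (bounds α) w
  ret-path {α} {w} adm@((pos , _) , u) =
    trans (retFrom-blocksPath m n 0 0 α (addIndices 0 w) (proj₁ (Admissible⇒Blocks adm)) (proj₂ (Admissible⇒Blocks adm)) n≤m)
          (touchingBlocks≡hits m n n≤m 0 0 0 α w z≤n pos u)

  run-path : ∀ {α w} → Admissible α w → run n (path α w) ≡ leadingZeros w
  run-path {[]}    ((_ , sum≡n) , _) = contradiction (sym sum≡n) (≢-nonZero⁻¹ n)
  run-path {a ∷ α} {x ∷ w} adm@((pos , sum≡n) , u@(cons _ x≤bound _))
    with refl ← n≤0⇒n≡0 (subst (x ≤_) (trans (cong (_/ n) (*-zeroʳ m)) (0/n≡0 n)) x≤bound) =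
    run-blocksPath m n (a ∷ α) w (proj₁ (Admissible⇒Blocks adm)) u (begin
      leadingZeros (0 ∷ w)         ≤⟨ leadingZeros≤length (0 ∷ w) ⟩
      length (0 ∷ w)               ≡⟨ sym (Under-length u) ⟩
      length (bounds (a ∷ α))      ≡⟨ length-blockBounds m n 0 0 (a ∷ α) ⟩
      length (a ∷ α)               ≤⟨ length≤sum pos ⟩
      sum (a ∷ α)                  ≡⟨ sum≡n ⟩
      n                            ∎)
    where open ≤-Reasoning

  decode : ∀ {P} → P ∈ D m n → P ≡ path (comp P) (shiftedBlockXs P) × Admissible (comp P) (shiftedBlockXs P)
  decode {P} P∈D = P≡path , (Blocks-positive bs , sum≡n) , u
    where
    α = comp P
    w = shiftedBlockXs P
    P∈lattice = proj₁ (∈-filter⁻ above? {xs = lattice m n} P∈D)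
    above = proj₂ (∈-filter⁻ above? {xs = lattice m n} P∈D)
    east = proj₁ (∈-lattice⁻ m n P∈lattice)
    north = proj₂ (∈-lattice⁻ m n P∈lattice)
    bs : Blocks 0 α (blockXs P)
    bs = Blocks-blockXs 0 P
    P≡ : P ≡ blocksPath m 0 α (blockXs P)
    P≡ = blocksPath-blockXs m 0 P east
    xs≡ : addIndices 0 w ≡ blockXs P
    xs≡ = addIndices-subIndices bs
    P≡path : P ≡ path α w
    P≡path = trans P≡ (cong (blocksPath m 0 α) (sym xs≡))
    ba : BlocksAbove m n 0 α (blockXs P)
    ba = BlocksAbove-aboveFrom m n 0 0 α (blockXs P) bs (subst (λ P′ → aboveFrom m n 0 0 P′ ≡ true) P≡ above)
    sum≡n : sum α ≡ n
    sum≡n = trans (sym (northSteps-blocksPath m 0 α (blockXs P) bs)) (trans (cong northSteps (sym P≡)) north)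
    u : Under 0 (bounds α) w
    u = Blocks⇒Under m n n≤m 0 0 0 α w z≤n (subst (Blocks 0 α) (sym xs≡) bs) (subst (BlocksAbove m n 0 α) (sym xs≡) ba)

  Φ-bounds : List ℕ → List ℕ → List ℕ
  Φ-bounds α = Φ (max 0 (bounds α)) (bounds α)

  Φ-bounds-admissible : ∀ {α w} → Admissible α w →
    Admissible α (Φ-bounds α w) × leadingZeros (Φ-bounds α w) ≡ hits (bounds α) w × Φ-bounds α (Φ-bounds α w) ≡ w
  Φ-bounds-admissible {α} (composition@(pos , _) , u) =
    let u′ , exchanges , involutive = Φ-zerosHitsInvolution (max 0 (bounds α)) bounded u
    in (composition , u′) , exchanges , involutive
    where
    bounded : BoundedBy (max 0 (bounds α)) (bounds α)
    bounded = blockBounds-increasing m n n≤m 0 0 0 α z≤n pos , xs≤max 0 (bounds α)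

  swapRunRet : List Step → List Step
  swapRunRet P = path (comp P) (Φ-bounds (comp P) (shiftedBlockXs P))

  swapRunRet-path : ∀ {α w} → Admissible α w → swapRunRet (path α w) ≡ path α (Φ-bounds α w)
  swapRunRet-path {α} {w} adm
    rewrite comp-path adm | blockXs-blocksPath m 0 α (addIndices 0 w) (proj₁ (Admissible⇒Blocks adm))
          | subIndices-addIndices 0 w = refl

  module _ {P} (P∈D : P ∈ D m n) where
    private
      α = comp P
      w = shiftedBlockXs P
      P≡ = proj₁ (decode P∈D)
      adm = proj₂ (decode P∈D)
      w′ = Φ-bounds α w
      Φ-w = Φ-bounds-admissible adm
      adm′ = proj₁ Φ-w

    swapRunRet-∈D : swapRunRet P ∈ D m n
    swapRunRet-∈D = path∈D adm′

    comp-swapRunRet : comp (swapRunRet P) ≡ comp P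
    comp-swapRunRet = comp-path adm′

    run-swapRunRet : run n (swapRunRet P) ≡ ret m n P
    run-swapRunRet = begin
      run n (path α w′)     ≡⟨ run-path adm′ ⟩
      leadingZeros w′       ≡⟨ proj₁ (proj₂ Φ-w) ⟩
      hits (bounds α) w     ≡⟨ sym (ret-path adm) ⟩
      ret m n (path α w)    ≡⟨ cong (ret m n) (sym P≡) ⟩
      ret m n P             ∎
      where open ≡-Reasoning

    ret-swapRunRet : ret m n (swapRunRet P) ≡ run n P
    ret-swapRunRet = begin
      ret m n (path α w′)             ≡⟨ ret-path adm′ ⟩
      hits (bounds α) w′              ≡⟨ sym (proj₁ (proj₂ (Φ-bounds-admissible adm′))) ⟩
      leadingZeros (Φ-bounds α w′)    ≡⟨ cong leadingZeros (proj₂ (proj₂ Φ-w)) ⟩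
      leadingZeros w                  ≡⟨ sym (run-path adm) ⟩
      run n (path α w)                ≡⟨ cong (run n) (sym P≡) ⟩
      run n P                         ∎
      where open ≡-Reasoning

    swapRunRet-involutive : swapRunRet (swapRunRet P) ≡ P
    swapRunRet-involutive = begin
      swapRunRet (path α w′)      ≡⟨ swapRunRet-path adm′ ⟩
      path α (Φ-bounds α w′)      ≡⟨ cong (path α) (proj₂ (proj₂ Φ-w)) ⟩
      path α w                    ≡⟨ sym P≡ ⟩
      P                           ∎
      where open ≡-Reasoning

  D-unique : Unique (D m n)
  D-unique = Unique.filter⁺ above? (lattice-unique m n)

  coeff-D-swap : ∀ a b → coeff (D m n) (run n) (ret m n) a b ≡ coeff (D m n) (ret m n) (run n) a b
  coeff-D-swap = coeff-swap swapRunRet D-unique swapRunRet-∈D swapRunRet-involutive run-swapRunRet ret-swapRunRet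

  coeff-Dcomp-swap : ∀ α a b → coeff (Dcomp m n α) (run n) (ret m n) a b ≡ coeff (Dcomp m n α) (ret m n) (run n) a b
  coeff-Dcomp-swap α =
    coeff-swap swapRunRet (Unique.filter⁺ comp? D-unique) closed
               (λ P∈ → swapRunRet-involutive (∈D P∈)) (λ P∈ → run-swapRunRet (∈D P∈)) (λ P∈ → ret-swapRunRet (∈D P∈))
    where
    comp? = λ P → ≡-dec _≟_ (comp P) α
    ∈D : ∀ {P} → P ∈ Dcomp m n α → P ∈ D m n
    ∈D P∈ = proj₁ (∈-filter⁻ comp? {xs = D m n} P∈)
    closed : ∀ {P} → P ∈ Dcomp m n α → swapRunRet P ∈ Dcomp m n α
    closed P∈ = ∈-filter⁺ comp? (swapRunRet-∈D (∈D P∈))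
                          (trans (comp-swapRunRet (∈D P∈)) (proj₂ (∈-filter⁻ comp? {xs = D m n} P∈)))

corollary3p3 : (m n : ℕ) → 0 < n → n < m →
    ((α : List ℕ) → IsComposition n α → (a b : ℕ) →
       coeff (Dcomp m n α) (run n) (ret m n) a b ≡ coeff (Dcomp m n α) (ret m n) (run n) a b)
    × ((a b : ℕ) →
       coeff (D m n) (run n) (ret m n) a b ≡ coeff (D m n) (ret m n) (run n) a b)
-- swapRunRet preserves the composition.
corollary3p3 m n 0<n n<m = (λ α _ → coeff-Dcomp-swap m n (<⇒≤ n<m) α) , coeff-D-swap m n (<⇒≤ n<m)
  where instance
  n≢0 : NonZero n
  n≢0 = >-nonZero 0<n
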